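{- Let $D$ be a $3$-anti-circulant digraph such that every proper induced subdigraph of $D$ satisfies the BE-property, and let $S$ be a maximum stable set of $D$. Let $v_1\leftrightarrow v_2$ be a digon in $D$. If $D\in\mathfrak{D}$ and there is a vertex $v_3\in V(D)\setminus\{v_1,v_2\}$ with $v_3\to v_1$, $v_3\to v_2$ and $\{v_1,v_2,v_3\}\cap S\neq\emptyset$, then $D$ admits an $S_{BE}$-path partition.
   Context: Digraphs are finite, loopless, without multiple arcs; $u\to v$ means $uv$ is an arc, and $u\leftrightarrow v$ (a digon) means both $u\to v$ and $v\to u$. A stable set is a set of pairwise non-adjacent vertices. A path partition is a collection of vertex-disjoint (directed) paths covering $V(D)$. For a stable set $S$, an $S_{BE}$-path partition is a path partition in which each path contains exactly one vertex of $S$ and that vertex is the first or last vertex of the path. A digraph satisfies the BE-property if for every maximum stable set $S$ it admits an $S_{BE}$-path partition. An anti-$P_4$ is a set of four distinct vertices with $v_1\to v_2$, $v_3\to v_2$, $v_3\to v_4$; $D$ is $3$-anti-circulant if for every such anti-$P_4$, $v_4\to v_1$. A blocking odd cycle is a digraph whose underlying simple graph is a cycle $x_1x_2\dots x_{2k+1}x_1$, $k\ge1$, with $x_1$ a source and $x_2$ a sink; $\mathfrak{D}$ is the class of digraphs containing no induced subdigraph that is a blocking odd cycle. -}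

module Defs where

open import Data.Nat using (ℕ; zero; suc; _+_; _*_; _≤_)
open import Data.Bool using (Bool; T)
open import Data.Fin using (Fin; toℕ)
open import Data.Fin.Subset using (Subset; _∈_; _⊆_; ∣_∣)
open import Data.List using (List; []; concat; head; last)
open import Data.List.Relation.Unary.All using (All)
open import Data.List.Relation.Unary.Linked using (Linked)
open import Data.List.Relation.Unary.Unique.Propositional using (Unique)
open import Data.Maybe using (just)
import Data.List.Membership.Propositional as LM
open import Data.Product using (Σ; ∃; _×_)
open import Data.Sum using (_⊎_)
open import Data.Empty using (⊥)
open import Relation.Nullary using (¬_)
open import Relation.Binary.PropositionalEquality using (_≡_; _≢_)
open import Function.Bundles using (_⇔_)

record Digraph : Set where
  field
    n        : ℕ
    arc      : Fin n → Fin n → Bool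
    loopless : ∀ v → ¬ T (arc v v)

module _ (D : Digraph) where
  open Digraph D

  _⇒_ : Fin n → Fin n → Set
  u ⇒ v = T (arc u v)

  Adjacent : Fin n → Fin n → Set
  Adjacent u v = (u ⇒ v) ⊎ (v ⇒ u)

  -- Everything below is relative to the induced subdigraph D[U], U ⊆ V(D).

  Stable : Subset n → Set
  Stable S = ∀ u v → u ∈ S → v ∈ S → ¬ Adjacent u v

  MaxStable : Subset n → Subset n → Set
  MaxStable U S = S ⊆ U × Stable S × (∀ T' → T' ⊆ U → Stable T' → ∣ T' ∣ ≤ ∣ S ∣)

  IsPath : List (Fin n) → Set
  IsPath P = ¬ (P ≡ []) × Unique P × Linked _⇒_ P

  IsPathPartition : Subset n → List (List (Fin n)) → Set
  IsPathPartition U Ps =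
    All IsPath Ps × Unique (concat Ps) × (∀ v → (v ∈ U) ⇔ (v LM.∈ concat Ps))

  BEPath : Subset n → List (Fin n) → Set
  BEPath S P = Σ (Fin n) λ s → s ∈ S × (head P ≡ just s ⊎ last P ≡ just s)
                 × (∀ w → w LM.∈ P → w ∈ S → w ≡ s)

  SBE-PathPartition : Subset n → Subset n → List (List (Fin n)) → Set
  SBE-PathPartition U S Ps = IsPathPartition U Ps × All (BEPath S) Ps

  BE-property : Subset n → Set
  BE-property U = ∀ S → MaxStable U S → ∃ λ Ps → SBE-PathPartition U S Ps

  AntiCirculant3 : Set
  AntiCirculant3 = ∀ v₁ v₂ v₃ v₄ →
    v₁ ≢ v₂ → v₁ ≢ v₃ → v₁ ≢ v₄ → v₂ ≢ v₃ → v₂ ≢ v₄ → v₃ ≢ v₄ →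
    v₁ ⇒ v₂ → v₃ ⇒ v₂ → v₃ ⇒ v₄ → v₄ ⇒ v₁

  CycSucc : (m : ℕ) → Fin m → Fin m → Set
  CycSucc m i j = suc (toℕ i) ≡ toℕ j ⊎ (suc (toℕ i) ≡ m × toℕ j ≡ 0)

  -- an induced blocking odd cycle x₀ x₁ … x_{2k} x₀ (k ≥ 1), x₀ a source, x₁ a sink
  -- (x₀, x₁ correspond to the paper's x₁, x₂)
  InducedBlockingOddCycle : Set
  InducedBlockingOddCycle =
    Σ ℕ λ k → 1 ≤ k × Σ (Fin (2 * k + 1) → Fin n) λ x →
      (∀ i j → x i ≡ x j → i ≡ j) ×
      (∀ i j → Adjacent (x i) (x j) ⇔ (CycSucc (2 * k + 1) i j ⊎ CycSucc (2 * k + 1) j i)) ×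
      (∀ i j → toℕ j ≡ 0 → ¬ (x i ⇒ x j)) ×
      (∀ i j → toℕ i ≡ 1 → ¬ (x i ⇒ x j))

  InClassD : Set
  InClassD = ¬ InducedBlockingOddCycle

-- Some w ∈ {v₁, v₂} lies outside S; by symmetry w = v₂, chosen so that if v₃ ∈ S then
-- v₁ ⇒ v₃, or neither v₁ nor v₂ sees v₃. S is still maximum stable in D − v₂, so D − v₂
-- has an S_BE-path partition, and it suffices to insert v₂ into one of its paths between
-- consecutive vertices a ⇒ v₂ ⇒ b without moving an S-vertex off the end of its path.
-- Anti-circularity gives v₂ ⇒ b for every out-neighbour b of v₃, so v₂ fits right after
-- v₃ unless v₃ is the S-end of its path. Then anti-circularity, together with the absence
-- of induced blocking triangles when v₁ ⇏ v₃, shows that v₂ dominates the out-neighbours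
-- of v₁ and the in-neighbours of v₃; scanning the path backwards from v₃ then finds a
-- slot for v₂, unless v₂ can already be placed directly before v₁.
module Submission where

open import Defs
open import Data.Empty using (⊥-elim)
open import Data.Fin using (Fin; zero; suc; toℕ; _≟_)
open import Data.Fin.Subset using (Subset; _∈_; _∉_; _⊂_; ⊤; ∁; ⁅_⁆)
open import Data.Fin.Subset.Properties using (∈⊤; _∈?_; x∉p⇒x∈∁p; x∈∁p⇒x∉p; x≢y⇒x∉⁅y⁆; x∉⁅y⁆⇒x≢y)
open import Data.List using (List; []; _∷_; _++_; [_]; _∷ʳ_; concat; head; last; initLast; _∷ʳ′_)
open import Data.List.Properties using (concat-++; ++-conicalʳ; ++-assoc; ++-identityʳ)
import Data.List.Membership.Propositional as L
open import Data.List.Membership.Propositional.Properties using (∈-concat⁻′; ∈-concat⁺′; ∈-∃++; ∈-++⁺ˡ; ∈-++⁺ʳ)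
open import Data.List.Relation.Unary.All as All using (All; _∷_)
open import Data.List.Relation.Unary.All.Properties using (¬Any⇒All¬; ++⁻ˡ; ++⁻ʳ; ++⁺)
open import Data.List.Relation.Unary.Any using (here; there)
open import Data.List.Relation.Unary.AllPairs using (_∷_)
open import Data.List.Relation.Unary.Linked as Linked using (Linked; []; [-]; _∷_; _∷′_)
import Data.List.Relation.Unary.Linked.Properties as Linkedₚ
open import Data.List.Relation.Unary.Unique.Propositional using (Unique)
open import Data.List.Relation.Unary.Unique.Propositional.Properties using (Unique[x∷xs]⇒x∉xs)
open import Data.List.Relation.Binary.Permutation.Propositional using (_↭_; ↭-sym; ↭⇒↭ₛ; module PermutationReasoning)
open import Data.List.Relation.Binary.Permutation.Propositional.Properties using (∈-resp-↭; shift; zoom)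
import Data.List.Relation.Binary.Permutation.Setoid.Properties as Permₛ
open import Data.Maybe using (Maybe; just)
open import Data.Maybe.Properties using (just-injective)
open import Data.Maybe.Relation.Binary.Connected using (Connected; just; just-nothing; nothing-just; nothing; drop-just)
open import Data.Nat using (s≤s; z≤n)
open import Data.Nat.Properties using (1+n≢n)
open import Data.Product using (∃; ∃₂; ∃-syntax; _×_; _,_; proj₁; proj₂)
open import Data.Sum using (_⊎_; inj₁; inj₂)
open import Function using (_∘_)
open import Function.Bundles using (_⇔_; mk⇔; Equivalence)
open import Relation.Nullary using (¬_; Dec; yes; no)
open import Relation.Nullary.Decidable using (T?; decidable-stable)
open import Relation.Binary.PropositionalEquality using (_≡_; _≢_; refl; sym; trans; cong; subst; ≢-sym; setoid)

module _ {A : Set} where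

  ++-∷-≢[] : ∀ (xs : List A) {y ys} → xs ++ y ∷ ys ≢ []
  ++-∷-≢[] xs = (λ ()) ∘ ++-conicalʳ xs _

  last-++ : ∀ (xs : List A) y ys → last (xs ++ y ∷ ys) ≡ last (y ∷ ys)
  last-++ []           y ys = refl
  last-++ (_ ∷ [])     y ys = refl
  last-++ (_ ∷ x ∷ xs) y ys = last-++ (x ∷ xs) y ys

  last-∷ʳ : ∀ (xs : List A) x → last (xs ∷ʳ x) ≡ just x
  last-∷ʳ xs x = last-++ xs x []

  last-∈ : ∀ (xs : List A) {x} → last xs ≡ just x → x L.∈ xs
  last-∈ (_ ∷ [])     refl = here refl
  last-∈ (_ ∷ y ∷ xs) eq   = there (last-∈ (y ∷ xs) eq)

  Unique-↭∷ : ∀ {xs w ys} → xs ↭ w ∷ ys → w L.∉ ys → Unique ys → Unique xs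
  Unique-↭∷ p w∉ u = Permₛ.Unique-resp-↭ (setoid A) (↭⇒↭ₛ (↭-sym p)) (¬Any⇒All¬ _ w∉ ∷ u)

  Unique-insert : ∀ xs {w : A} {ys} → w L.∉ xs ++ ys → Unique (xs ++ ys) → Unique (xs ++ w ∷ ys)
  Unique-insert xs {w} {ys} = Unique-↭∷ (shift w xs ys)

  Unique-∉-prefix : ∀ xs {x : A} {ys} → Unique (xs ++ x ∷ ys) → x L.∉ xs
  Unique-∉-prefix xs {x} {ys} u x∈ =
    Unique[x∷xs]⇒x∉xs (Permₛ.Unique-resp-↭ (setoid A) (↭⇒↭ₛ (shift x xs ys)) u) (∈-++⁺ˡ x∈)

  concat-insert-↭ : ∀ Ps₁ Ps₂ xs (w : A) ys →
    concat (Ps₁ ++ (xs ++ w ∷ ys) ∷ Ps₂) ↭ w ∷ concat (Ps₁ ++ (xs ++ ys) ∷ Ps₂)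
  concat-insert-↭ Ps₁ Ps₂ xs w ys = begin
    concat (Ps₁ ++ (xs ++ w ∷ ys) ∷ Ps₂)  ≡⟨ sym (concat-++ Ps₁ _) ⟩
    C₁ ++ (xs ++ w ∷ ys) ++ C₂            ↭⟨ zoom C₁ (shift w xs ys) ⟩
    C₁ ++ (w ∷ xs ++ ys) ++ C₂            ↭⟨ shift w C₁ _ ⟩
    w ∷ C₁ ++ (xs ++ ys) ++ C₂            ≡⟨ cong (w ∷_) (concat-++ Ps₁ _) ⟩
    w ∷ concat (Ps₁ ++ (xs ++ ys) ∷ Ps₂)  ∎
    where
    open PermutationReasoning
    C₁ C₂ : List A
    C₁ = concat Ps₁
    C₂ = concat Ps₂

  All-replace : ∀ {P : List A → Set} Ps₁ {xs ys Ps₂} →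
    All P (Ps₁ ++ xs ∷ Ps₂) → P ys → All P (Ps₁ ++ ys ∷ Ps₂)
  All-replace Ps₁ ps p = ++⁺ (++⁻ˡ Ps₁ ps) (p ∷ All.tail (++⁻ʳ Ps₁ ps))

module _ {A : Set} {R : A → A → Set} where

  Connected-last⁺ : ∀ xs {x w} → last xs ≡ just x → R x w → Connected R (last xs) (just w)
  Connected-last⁺ _ eq r = subst (λ m → Connected R m _) (sym eq) (just r)

  Connected-last⁻ : ∀ xs {x w} → last xs ≡ just x → Connected R (last xs) (just w) → R x w
  Connected-last⁻ _ eq c = drop-just (subst (λ m → Connected R m _) eq c)

  Linked-++⁻ : ∀ xs {ys} → Linked R (xs ++ ys) →
    Linked R xs × Connected R (last xs) (head ys) × Linked R ys
  Linked-++⁻ []           {[]}    l       = [] , nothing , l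
  Linked-++⁻ []           {_ ∷ _} l       = [] , nothing-just , l
  Linked-++⁻ (_ ∷ [])     {[]}    l       = [-] , just-nothing , []
  Linked-++⁻ (_ ∷ [])     {_ ∷ _} (r ∷ l) = [-] , just r , l
  Linked-++⁻ (_ ∷ y ∷ xs)         (r ∷ l) =
    let lx , c , ly = Linked-++⁻ (y ∷ xs) l in r ∷ lx , c , ly

  Linked-insert : ∀ xs {w ys} → Linked R (xs ++ ys) →
    Connected R (last xs) (just w) → Connected R (just w) (head ys) → Linked R (xs ++ w ∷ ys)
  Linked-insert xs l cx cy = let lx , _ , ly = Linked-++⁻ xs l in Linkedₚ.++⁺ lx cx (cy ∷′ ly)

  Linked-step : ∀ xs {x y ys} → Linked R (xs ++ x ∷ y ∷ ys) → R x y
  Linked-step xs l = Linked.head (proj₂ (proj₂ (Linked-++⁻ xs l)))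

  -- Scanning from the end of the list: while R w q′, the predecessor q of q′ either
  -- satisfies R q w (a slot for w is found) or R w q (continue with q).
  insertion-slot : ∀ w x xs → Linked R (x ∷ xs) →
    (∀ {q q′} → q L.∈ x ∷ xs → q′ L.∈ x ∷ xs → R q q′ → R w q′ → R q w ⊎ R w q) →
    (∀ {y} → last (x ∷ xs) ≡ just y → R w y) →
    ∃[ ys ] ∃[ z ] ∃[ zs ] (x ∷ xs ≡ ys ++ z ∷ zs × Connected R (last ys) (just w) × R w z)
  insertion-slot w x [] _ _ w⇒last = [] , x , [] , refl , nothing-just , w⇒last refl
  insertion-slot w x (x′ ∷ xs) (x⇒x′ ∷ l) back w⇒last
    with insertion-slot w x′ xs l (λ q∈ q′∈ → back (there q∈) (there q′∈)) w⇒last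
  ... | [] , _ , _ , refl , _ , w⇒x′ with back (here refl) (there (here refl)) x⇒x′ w⇒x′
  ...   | inj₁ x⇒w = x ∷ [] , x′ , xs , refl , just x⇒w , w⇒x′
  ...   | inj₂ w⇒x = [] , x , x′ ∷ xs , refl , nothing-just , w⇒x
  insertion-slot w x (x′ ∷ xs) (x⇒x′ ∷ l) back w⇒last
      | y ∷ ys , z , zs , refl , c , w⇒z = x ∷ y ∷ ys , z , zs , refl , c , w⇒z

module Arcs (D : Digraph) where
  open Digraph D

  private
    _⟶_ : Fin n → Fin n → Set
    _⟶_ = _⇒_ D

  ⇒-≢ : ∀ {u v} → u ⟶ v → u ≢ v
  ⇒-≢ {u} u⇒v refl = loopless u u⇒v

  ¬¬-⇒ : ∀ {u v} → ¬ ¬ u ⟶ v → u ⟶ v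
  ¬¬-⇒ {u} {v} = decidable-stable (T? (arc u v))

  blocking-triangle : ∀ {a b c} → a ⟶ b → a ⟶ c → c ⟶ b → ¬ b ⟶ a → ¬ c ⟶ a → ¬ b ⟶ c →
    InducedBlockingOddCycle D
  blocking-triangle {a} {b} {c} a⇒b a⇒c c⇒b ¬b⇒a ¬c⇒a ¬b⇒c =
    1 , s≤s z≤n , x , injective , adjacent , source , sink
    where
    x : Fin 3 → Fin n
    x zero = a
    x (suc zero) = b
    x (suc (suc zero)) = c
    injective : ∀ i j → x i ≡ x j → i ≡ j
    injective zero             zero             _ = refl
    injective zero             (suc zero)       e = ⊥-elim (⇒-≢ a⇒b e)
    injective zero             (suc (suc zero)) e = ⊥-elim (⇒-≢ a⇒c e)
    injective (suc zero)       zero             e = ⊥-elim (⇒-≢ a⇒b (sym e))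
    injective (suc zero)       (suc zero)       _ = refl
    injective (suc zero)       (suc (suc zero)) e = ⊥-elim (⇒-≢ c⇒b (sym e))
    injective (suc (suc zero)) zero             e = ⊥-elim (⇒-≢ a⇒c (sym e))
    injective (suc (suc zero)) (suc zero)       e = ⊥-elim (⇒-≢ c⇒b e)
    injective (suc (suc zero)) (suc (suc zero)) _ = refl
    CS : Fin 3 → Fin 3 → Set
    CS = CycSucc D 3
    irreflexive : ∀ i → ¬ CS i i
    irreflexive _       (inj₁ e)        = 1+n≢n e
    irreflexive zero    (inj₂ (() , _))
    irreflexive (suc _) (inj₂ (_ , ()))
    off-diagonal : ∀ i j → i ≢ j → Adjacent D (x i) (x j) × (CS i j ⊎ CS j i)
    off-diagonal zero             (suc zero)       _ = inj₁ a⇒b , inj₁ (inj₁ refl)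
    off-diagonal zero             (suc (suc zero)) _ = inj₁ a⇒c , inj₂ (inj₂ (refl , refl))
    off-diagonal (suc zero)       zero             _ = inj₂ a⇒b , inj₂ (inj₁ refl)
    off-diagonal (suc zero)       (suc (suc zero)) _ = inj₂ c⇒b , inj₁ (inj₁ refl)
    off-diagonal (suc (suc zero)) zero             _ = inj₂ a⇒c , inj₁ (inj₂ (refl , refl))
    off-diagonal (suc (suc zero)) (suc zero)       _ = inj₁ c⇒b , inj₂ (inj₁ refl)
    off-diagonal zero             zero             i≢i = ⊥-elim (i≢i refl)
    off-diagonal (suc zero)       (suc zero)       i≢i = ⊥-elim (i≢i refl)
    off-diagonal (suc (suc zero)) (suc (suc zero)) i≢i = ⊥-elim (i≢i refl)
    adjacent : ∀ i j → Adjacent D (x i) (x j) ⇔ (CS i j ⊎ CS j i)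
    adjacent i j with i ≟ j
    ... | yes refl = mk⇔ (λ { (inj₁ p) → ⊥-elim (loopless (x i) p) ; (inj₂ p) → ⊥-elim (loopless (x i) p) })
                         (λ { (inj₁ c) → ⊥-elim (irreflexive i c) ; (inj₂ c) → ⊥-elim (irreflexive i c) })
    ... | no i≢j   = mk⇔ (λ _ → proj₂ (off-diagonal i j i≢j)) (λ _ → proj₁ (off-diagonal i j i≢j))
    source : ∀ i j → toℕ j ≡ 0 → ¬ x i ⟶ x j
    source zero             zero    _ = loopless a
    source (suc zero)       zero    _ = ¬b⇒a
    source (suc (suc zero)) zero    _ = ¬c⇒a
    sink : ∀ i j → toℕ i ≡ 1 → ¬ x i ⟶ x j
    sink (suc zero) zero             _ = ¬b⇒a
    sink (suc zero) (suc zero)       _ = loopless b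
    sink (suc zero) (suc (suc zero)) _ = ¬b⇒c

module PathPartitions (D : Digraph) (S : Subset (Digraph.n D)) where
  open Digraph D

  private
    V : Set
    V = Fin n
    _⟶_ : V → V → Set
    _⟶_ = _⇒_ D

  ∈∁⁅⁆⇒≢ : ∀ {v w : V} → v ∈ ∁ ⁅ w ⁆ → v ≢ w
  ∈∁⁅⁆⇒≢ = x∉⁅y⁆⇒x≢y ∘ x∈∁p⇒x∉p

  ≢⇒∈∁⁅⁆ : ∀ {v w : V} → v ≢ w → v ∈ ∁ ⁅ w ⁆
  ≢⇒∈∁⁅⁆ = x∉p⇒x∈∁p ∘ x≢y⇒x∉⁅y⁆

  ∁⁅⁆⊂⊤ : ∀ (w : V) → ∁ ⁅ w ⁆ ⊂ ⊤
  ∁⁅⁆⊂⊤ w = (λ _ → ∈⊤) , w , ∈⊤ , λ w∈ → ∈∁⁅⁆⇒≢ w∈ refl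

  MaxStable-∁⁅⁆ : ∀ {w} → MaxStable D ⊤ S → w ∉ S → MaxStable D (∁ ⁅ w ⁆) S
  MaxStable-∁⁅⁆ (_ , stable , maximum) w∉S =
    (λ v∈S → ≢⇒∈∁⁅⁆ λ { refl → w∉S v∈S }) , stable , λ T _ → maximum T (λ _ → ∈⊤)

  located : ∀ {U Ps v} → IsPathPartition D U Ps → v ∈ U → ∃₂ λ xs ys → (xs ++ v ∷ ys) L.∈ Ps
  located (_ , _ , cover) v∈U with ∈-concat⁻′ _ (Equivalence.to (cover _) v∈U)
  ... | _ , v∈P , P∈Ps with ∈-∃++ v∈P
  ...   | xs , ys , refl = xs , ys , P∈Ps

  EndInS : Maybe V → Set
  EndInS m = ∃ λ s → s ∈ S × m ≡ just s

  -- sufficient for the S-vertex of P = X ++ Y to stay at an end of X ++ w ∷ Y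
  KeepsEnds : List V → List V → List V → Set
  KeepsEnds P X Y = (X ≡ [] → EndInS (last P)) × (Y ≡ [] → EndInS (head P))

  BEPath-head∉ : ∀ {P x} → BEPath D S P → head P ≡ just x → x ∉ S → EndInS (last P)
  BEPath-head∉ (s , s∈S , inj₁ first , _) eq x∉S =
    ⊥-elim (x∉S (subst (_∈ S) (just-injective (trans (sym first) eq)) s∈S))
  BEPath-head∉ (s , s∈S , inj₂ final , _) _  _   = s , s∈S , final

  BEPath-last∉ : ∀ {P x} → BEPath D S P → last P ≡ just x → x ∉ S → EndInS (head P)
  BEPath-last∉ (s , s∈S , inj₁ first , _) _  _   = s , s∈S , first
  BEPath-last∉ (s , s∈S , inj₂ final , _) eq x∉S =
    ⊥-elim (x∉S (subst (_∈ S) (just-injective (trans (sym final) eq)) s∈S))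

  ends-insert : ∀ X {w} Y {s} → KeepsEnds (X ++ Y) X Y → (∀ v → v L.∈ X ++ Y → v ∈ S → v ≡ s) →
    (head (X ++ Y) ≡ just s ⊎ last (X ++ Y) ≡ just s) →
    (head (X ++ w ∷ Y) ≡ just s ⊎ last (X ++ w ∷ Y) ≡ just s)
  ends-insert (_ ∷ _) (_ ∷ _) _ _ (inj₁ first) = inj₁ first
  ends-insert X@(_ ∷ _) {w} (y ∷ Y) _ _ (inj₂ final) =
    inj₂ (trans (last-++ X w (y ∷ Y)) (trans (sym (last-++ X y Y)) final))
  ends-insert [] (y ∷ Y) (atFront , _) only _ =
    let t , t∈S , final = atFront refl in inj₂ (trans final (cong just (only t (last-∈ (y ∷ Y) final) t∈S)))
  ends-insert (x ∷ X) [] (_ , atBack) only _ =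
    let t , t∈S , first = atBack refl in inj₁ (trans first (cong just (only t (here (just-injective (sym first))) t∈S)))
  ends-insert [] [] _ _ (inj₁ ())
  ends-insert [] [] _ _ (inj₂ ())

  BEPath-insert : ∀ X {w} Y → w ∉ S → KeepsEnds (X ++ Y) X Y → BEPath D S (X ++ Y) → BEPath D S (X ++ w ∷ Y)
  BEPath-insert X {w} Y w∉S keeps (s , s∈S , end , only) = s , s∈S , ends-insert X Y keeps only end , only′
    where
    only′ : ∀ v → v L.∈ X ++ w ∷ Y → v ∈ S → v ≡ s
    only′ v v∈ v∈S with ∈-resp-↭ (shift w X Y) v∈
    ... | here refl = ⊥-elim (w∉S v∈S)
    ... | there v∈P = only v v∈P v∈S

  IsPath-insert : ∀ X {w} Y → w L.∉ X ++ Y →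
    Connected _⟶_ (last X) (just w) → Connected _⟶_ (just w) (head Y) →
    IsPath D (X ++ Y) → IsPath D (X ++ w ∷ Y)
  IsPath-insert X Y w∉ cX cY (_ , unique , linked) =
    ++-∷-≢[] X , Unique-insert X w∉ unique , Linked-insert X linked cX cY

  insert-vertex : ∀ {w Ps P} X Y → P ≡ X ++ Y → w ∉ S → SBE-PathPartition D (∁ ⁅ w ⁆) S Ps → P L.∈ Ps →
    Connected _⟶_ (last X) (just w) → Connected _⟶_ (just w) (head Y) → KeepsEnds P X Y →
    ∃ λ Ps′ → SBE-PathPartition D ⊤ S Ps′
  insert-vertex {w} X Y refl w∉S ((paths , unique , cover) , bePaths) P∈Ps cX cY keeps with ∈-∃++ P∈Ps
  ... | Ps₁ , Ps₂ , refl =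
    Ps₁ ++ (X ++ w ∷ Y) ∷ Ps₂ ,
    ( All-replace Ps₁ paths (IsPath-insert X Y w∉P cX cY (All.lookup paths P∈Ps))
    , Unique-↭∷ perm w∉Ps unique
    , λ v → mk⇔ (λ _ → ∈-resp-↭ (↭-sym perm) (covered v)) (λ _ → ∈⊤) ) ,
    All-replace Ps₁ bePaths (BEPath-insert X Y w∉S keeps (All.lookup bePaths P∈Ps))
    where
    w∉Ps : w L.∉ concat (Ps₁ ++ (X ++ Y) ∷ Ps₂)
    w∉Ps w∈ = ∈∁⁅⁆⇒≢ (Equivalence.from (cover w) w∈) refl
    w∉P : w L.∉ X ++ Y
    w∉P w∈ = w∉Ps (∈-concat⁺′ w∈ P∈Ps)
    perm : concat (Ps₁ ++ (X ++ w ∷ Y) ∷ Ps₂) ↭ w ∷ concat (Ps₁ ++ (X ++ Y) ∷ Ps₂)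
    perm = concat-insert-↭ Ps₁ Ps₂ X w Y
    covered : ∀ v → v L.∈ w ∷ concat (Ps₁ ++ (X ++ Y) ∷ Ps₂)
    covered v with v ≟ w
    ... | yes refl = here refl
    ... | no v≢w = there (Equivalence.to (cover v) (≢⇒∈∁⁅⁆ v≢w))

module DominatedDigon (D : Digraph) (anti : AntiCirculant3 D) {v₁ v₂ v₃ : Fin (Digraph.n D)}
  (v₁⇒v₂ : _⇒_ D v₁ v₂) (v₂⇒v₁ : _⇒_ D v₂ v₁) (v₃⇒v₁ : _⇒_ D v₃ v₁) (v₃⇒v₂ : _⇒_ D v₃ v₂) where
  open Digraph D
  open Arcs D

  private
    V : Set
    V = Fin n
    _⟶_ : V → V → Set
    _⟶_ = _⇒_ D

  anti-P₄ : ∀ {a b c d} → a ⟶ b → c ⟶ b → c ⟶ d → a ≢ c → a ≢ d → b ≢ d → d ⟶ a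
  anti-P₄ a⇒b c⇒b c⇒d a≢c a≢d b≢d =
    anti _ _ _ _ (⇒-≢ a⇒b) a≢c a≢d (≢-sym (⇒-≢ c⇒b)) b≢d (⇒-≢ c⇒d) a⇒b c⇒b c⇒d

  v₁≢v₂ : v₁ ≢ v₂
  v₁≢v₂ = ⇒-≢ v₁⇒v₂

  v₃≢v₁ : v₃ ≢ v₁
  v₃≢v₁ = ⇒-≢ v₃⇒v₁

  v₃≢v₂ : v₃ ≢ v₂
  v₃≢v₂ = ⇒-≢ v₃⇒v₂

  Dominates-N⁺v₁ : Set
  Dominates-N⁺v₁ = ∀ {q} → q ≢ v₁ → q ≢ v₂ → q ≢ v₃ → v₁ ⟶ q → v₂ ⟶ q

  Dominates-N⁻v₃ : Set
  Dominates-N⁻v₃ = ∀ {a} → a ≢ v₂ → a ≢ v₃ → a ⟶ v₃ → v₂ ⟶ a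

  dominates-N⁺v₃ : ∀ {b} → b ≢ v₂ → v₃ ⟶ b → v₂ ⟶ b
  dominates-N⁺v₃ {b} b≢v₂ v₃⇒b with b ≟ v₁
  ... | yes refl = v₂⇒v₁
  ... | no b≢v₁  = anti-P₄ b⇒v₁ v₃⇒v₁ v₃⇒v₂ (≢-sym (⇒-≢ v₃⇒b)) b≢v₂ v₁≢v₂
    where
    b⇒v₁ : b ⟶ v₁
    b⇒v₁ = anti-P₄ v₁⇒v₂ v₃⇒v₂ v₃⇒b (≢-sym v₃≢v₁) (≢-sym b≢v₁) (≢-sym b≢v₂)

  N⁺v₁⇒v₃ : ∀ {q} → q ≢ v₂ → q ≢ v₃ → v₁ ⟶ q → q ⟶ v₃
  N⁺v₁⇒v₃ q≢v₂ q≢v₃ v₁⇒q = anti-P₄ v₃⇒v₂ v₁⇒v₂ v₁⇒q v₃≢v₁ (≢-sym q≢v₃) (≢-sym q≢v₂)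

  backward-step : Dominates-N⁺v₁ → ∀ {q q′} → q ≢ v₂ → q ≢ v₃ → q′ ≢ v₂ →
    q ⟶ q′ → v₂ ⟶ q′ → q ⟶ v₂ ⊎ v₂ ⟶ q
  backward-step dom {q} {q′} q≢v₂ q≢v₃ q′≢v₂ q⇒q′ v₂⇒q′ with q ≟ v₁ | q′ ≟ v₁
  ... | yes refl | _         = inj₁ v₁⇒v₂
  ... | no q≢v₁  | yes refl  = inj₂ (anti-P₄ q⇒q′ v₃⇒v₁ v₃⇒v₂ q≢v₃ q≢v₂ v₁≢v₂)
  ... | no q≢v₁  | no q′≢v₁  = inj₂ (dom q≢v₁ q≢v₂ q≢v₃ (anti-P₄ q⇒q′ v₂⇒q′ v₂⇒v₁ q≢v₂ q≢v₁ q′≢v₁))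

  module WithArc₁₃ (v₁⇒v₃ : v₁ ⟶ v₃) where

    dominates-N⁺v₁ : Dominates-N⁺v₁
    dominates-N⁺v₁ q≢v₁ q≢v₂ q≢v₃ v₁⇒q =
      anti-P₄ (N⁺v₁⇒v₃ q≢v₂ q≢v₃ v₁⇒q) v₁⇒v₃ v₁⇒v₂ q≢v₁ q≢v₂ v₃≢v₂

    dominates-N⁻v₃ : Dominates-N⁻v₃
    dominates-N⁻v₃ {a} a≢v₂ _ a⇒v₃ with a ≟ v₁
    ... | yes refl = v₂⇒v₁
    ... | no a≢v₁  = anti-P₄ a⇒v₃ v₁⇒v₃ v₁⇒v₂ a≢v₁ a≢v₂ v₃≢v₂

  module Blocked (inClassD : InClassD D) {x} (x≢v₂ : x ≢ v₂) (x⇒v₁ : x ⟶ v₁) (¬x⇒v₂ : ¬ x ⟶ v₂)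
                 (¬v₁⇒v₃ : ¬ v₁ ⟶ v₃) (¬v₂⇒v₃ : ¬ v₂ ⟶ v₃) where

    x≢v₁ : x ≢ v₁
    x≢v₁ = ⇒-≢ x⇒v₁

    x≢v₃ : x ≢ v₃
    x≢v₃ refl = ¬x⇒v₂ v₃⇒v₂

    v₂⇒x : v₂ ⟶ x
    v₂⇒x = anti-P₄ x⇒v₁ v₃⇒v₁ v₃⇒v₂ x≢v₃ x≢v₂ v₁≢v₂

    x⇒v₃ : x ⟶ v₃
    x⇒v₃ = anti-P₄ v₃⇒v₁ v₂⇒v₁ v₂⇒x v₃≢v₂ (≢-sym x≢v₃) (≢-sym x≢v₁)

    ¬v₃⇒x : ¬ v₃ ⟶ x
    ¬v₃⇒x v₃⇒x = ¬x⇒v₂ (anti-P₄ v₂⇒v₁ v₃⇒v₁ v₃⇒x (≢-sym v₃≢v₂) (≢-sym x≢v₂) (≢-sym x≢v₁))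

    v₁⇒x : v₁ ⟶ x
    v₁⇒x = ¬¬-⇒ λ ¬v₁⇒x → inClassD (blocking-triangle x⇒v₁ x⇒v₃ v₃⇒v₁ ¬v₁⇒x ¬v₃⇒x ¬v₁⇒v₃)

    dominates-N⁺v₁ : Dominates-N⁺v₁
    dominates-N⁺v₁ {q} q≢v₁ q≢v₂ q≢v₃ v₁⇒q with q ≟ x
    ... | yes refl = v₂⇒x
    ... | no q≢x   =
      ¬¬-⇒ λ ¬v₂⇒q → inClassD (blocking-triangle q⇒v₂ q⇒v₃ v₃⇒v₂ ¬v₂⇒q ¬v₃⇒q ¬v₂⇒v₃)
      where
      q⇒v₂ : q ⟶ v₂
      q⇒v₂ = anti-P₄ v₂⇒x v₁⇒x v₁⇒q (≢-sym v₁≢v₂) (≢-sym q≢v₂) (≢-sym q≢x)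
      q⇒v₃ : q ⟶ v₃
      q⇒v₃ = N⁺v₁⇒v₃ q≢v₂ q≢v₃ v₁⇒q
      ¬v₃⇒q : ¬ v₃ ⟶ q
      ¬v₃⇒q v₃⇒q = ¬v₃⇒x (anti-P₄ x⇒v₁ q⇒v₁ q⇒v₃ (≢-sym q≢x) x≢v₃ (≢-sym v₃≢v₁))
        where
        q⇒v₁ : q ⟶ v₁
        q⇒v₁ = anti-P₄ v₁⇒v₂ v₃⇒v₂ v₃⇒q (≢-sym v₃≢v₁) (≢-sym q≢v₁) (≢-sym q≢v₂)

    dominates-N⁻v₃ : Dominates-N⁻v₃
    dominates-N⁻v₃ {a} a≢v₂ a≢v₃ a⇒v₃ with a ≟ v₁ | a ≟ x
    ... | yes refl | _        = ⊥-elim (¬v₁⇒v₃ a⇒v₃)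
    ... | no _     | yes refl = v₂⇒x
    ... | no a≢v₁  | no a≢x   =
      dominates-N⁺v₁ a≢v₁ a≢v₂ a≢v₃ (anti-P₄ a⇒v₃ x⇒v₃ x⇒v₁ a≢x a≢v₁ v₃≢v₁)

module Extension (D : Digraph) (S : Subset (Digraph.n D)) (anti : AntiCirculant3 D) (inClassD : InClassD D)
  {v₁ v₂ v₃ : Fin (Digraph.n D)}
  (v₁⇒v₂ : _⇒_ D v₁ v₂) (v₂⇒v₁ : _⇒_ D v₂ v₁) (v₃⇒v₁ : _⇒_ D v₃ v₁) (v₃⇒v₂ : _⇒_ D v₃ v₂)
  (stable : Stable D S) (v₂∉S : v₂ ∉ S) {Ps} (partition : SBE-PathPartition D (∁ ⁅ v₂ ⁆) S Ps) where
  open Digraph D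
  open Arcs D
  open PathPartitions D S
  open DominatedDigon D anti v₁⇒v₂ v₂⇒v₁ v₃⇒v₁ v₃⇒v₂

  private
    V : Set
    V = Fin n
    _⟶_ : V → V → Set
    _⟶_ = _⇒_ D

  Extended : Set
  Extended = ∃ λ Ps′ → SBE-PathPartition D ⊤ S Ps′

  insert : ∀ {P} X Y → P ≡ X ++ Y → P L.∈ Ps →
    Connected _⟶_ (last X) (just v₂) → Connected _⟶_ (just v₂) (head Y) → KeepsEnds P X Y → Extended
  insert X Y eq = insert-vertex X Y eq v₂∉S partition

  isPath : ∀ {P} → P L.∈ Ps → IsPath D P
  isPath = All.lookup (proj₁ (proj₁ partition))

  linkedPath : ∀ {P} → P L.∈ Ps → Linked _⟶_ P
  linkedPath = proj₂ ∘ proj₂ ∘ isPath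

  isBEPath : ∀ {P} → P L.∈ Ps → BEPath D S P
  isBEPath = All.lookup (proj₂ partition)

  ≢v₂ : ∀ {P v} → P L.∈ Ps → v L.∈ P → v ≢ v₂
  ≢v₂ P∈ v∈ = ∈∁⁅⁆⇒≢ (Equivalence.from (proj₂ (proj₂ (proj₁ partition)) _) (∈-concat⁺′ v∈ P∈))

  located-≢v₂ : ∀ {v} → v ≢ v₂ → ∃₂ λ xs ys → (xs ++ v ∷ ys) L.∈ Ps
  located-≢v₂ = located (proj₁ partition) ∘ ≢⇒∈∁⁅⁆

  insert-before-v₃ : Dominates-N⁺v₁ → Dominates-N⁻v₃ → v₃ ∈ S → ∀ a A → ((a ∷ A) ∷ʳ v₃) L.∈ Ps → Extended
  insert-before-v₃ dom₁ dom₃ v₃∈S a A P∈ =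
    let ys , z , zs , eq , cY , v₂⇒z = insertion-slot v₂ a A linkedA backward v₂⇒last
    in insert ys (z ∷ zs ∷ʳ v₃) (trans (cong (_∷ʳ v₃) eq) (++-assoc ys (z ∷ zs) [ v₃ ])) P∈ cY (just v₂⇒z)
         ((λ _ → v₃ , v₃∈S , last-∷ʳ (a ∷ A) v₃) , λ ())
    where
    linkedA : Linked _⟶_ (a ∷ A)
    linkedA = proj₁ (Linked-++⁻ (a ∷ A) (linkedPath P∈))
    into-v₃ : Connected _⟶_ (last (a ∷ A)) (just v₃)
    into-v₃ = proj₁ (proj₂ (Linked-++⁻ (a ∷ A) (linkedPath P∈)))
    ≢v₂′ : ∀ {q} → q L.∈ a ∷ A → q ≢ v₂
    ≢v₂′ = ≢v₂ P∈ ∘ ∈-++⁺ˡ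
    ≢v₃ : ∀ {q} → q L.∈ a ∷ A → q ≢ v₃
    ≢v₃ q∈ refl = Unique-∉-prefix (a ∷ A) (proj₁ (proj₂ (isPath P∈))) q∈
    backward : ∀ {q q′} → q L.∈ a ∷ A → q′ L.∈ a ∷ A → q ⟶ q′ → v₂ ⟶ q′ → q ⟶ v₂ ⊎ v₂ ⟶ q
    backward q∈ q′∈ = backward-step dom₁ (≢v₂′ q∈) (≢v₃ q∈) (≢v₂′ q′∈)
    v₂⇒last : ∀ {y} → last (a ∷ A) ≡ just y → v₂ ⟶ y
    v₂⇒last eq =
      let y∈ = last-∈ (a ∷ A) eq in dom₃ (≢v₂′ y∈) (≢v₃ y∈) (Connected-last⁻ (a ∷ A) eq into-v₃)

  insert-near-v₁ : v₃ ∈ S → ¬ v₁ ⟶ v₃ → ¬ v₂ ⟶ v₃ → ∀ a A → ((a ∷ A) ∷ʳ v₃) L.∈ Ps → Extended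
  insert-near-v₁ v₃∈S ¬v₁⇒v₃ ¬v₂⇒v₃ a A P∈ with located-≢v₂ v₁≢v₂
  ... | L , R , Q∈ with initLast L
  ...   | [] = insert [] (v₁ ∷ R) refl Q∈ nothing-just (just v₂⇒v₁)
          ((λ _ → BEPath-head∉ (isBEPath Q∈) refl v₁∉S) , λ ())
    where
    v₁∉S : v₁ ∉ S
    v₁∉S v₁∈S = stable v₃ v₁ v₃∈S v₁∈S (inj₁ v₃⇒v₁)
  ...   | L′ ∷ʳ′ x with T? (arc x v₂)
  ...     | yes x⇒v₂ = insert (L′ ∷ʳ x) (v₁ ∷ R) refl Q∈
            (Connected-last⁺ (L′ ∷ʳ x) (last-∷ʳ L′ x) x⇒v₂) (just v₂⇒v₁)
            ((⊥-elim ∘ ++-∷-≢[] L′) , λ ())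
  ...     | no ¬x⇒v₂ = insert-before-v₃ B.dominates-N⁺v₁ B.dominates-N⁻v₃ v₃∈S a A P∈
    where
    x⇒v₁ : x ⟶ v₁
    x⇒v₁ = Connected-last⁻ (L′ ∷ʳ x) (last-∷ʳ L′ x) (proj₁ (proj₂ (Linked-++⁻ (L′ ∷ʳ x) (linkedPath Q∈))))
    module B = Blocked inClassD (≢v₂ Q∈ (∈-++⁺ˡ (∈-++⁺ʳ L′ (here refl)))) x⇒v₁ ¬x⇒v₂ ¬v₁⇒v₃ ¬v₂⇒v₃

  extended : (v₃ ∈ S → v₁ ⟶ v₃ ⊎ (¬ v₁ ⟶ v₃ × ¬ v₂ ⟶ v₃)) → Extended
  extended arcs-at-v₃ with located-≢v₂ v₃≢v₂
  ... | A , b ∷ B , P∈ = insert (A ∷ʳ v₃) (b ∷ B) (sym (++-assoc A [ v₃ ] (b ∷ B))) P∈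
        (Connected-last⁺ (A ∷ʳ v₃) (last-∷ʳ A v₃) v₃⇒v₂)
        (just (dominates-N⁺v₃ (≢v₂ P∈ (∈-++⁺ʳ A (there (here refl)))) (Linked-step A (linkedPath P∈))))
        ((⊥-elim ∘ ++-∷-≢[] A) , λ ())
  ... | A , [] , P∈ with v₃ ∈? S
  ...   | no v₃∉S = append-after-v₃ (BEPath-last∉ (isBEPath P∈) (last-∷ʳ A v₃) v₃∉S)
    where
    append-after-v₃ : EndInS (head (A ∷ʳ v₃)) → Extended
    append-after-v₃ first = insert (A ∷ʳ v₃) [] (sym (++-identityʳ _)) P∈
      (Connected-last⁺ (A ∷ʳ v₃) (last-∷ʳ A v₃) v₃⇒v₂) just-nothing ((⊥-elim ∘ ++-∷-≢[] A) , λ _ → first)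
  ...   | yes v₃∈S with A | arcs-at-v₃ v₃∈S
  ...     | []     | _ = insert [ v₃ ] [] refl P∈ (just v₃⇒v₂) just-nothing ((λ ()) , λ _ → v₃ , v₃∈S , refl)
  ...     | a ∷ A′ | inj₁ v₁⇒v₃ =
    insert-before-v₃ (WithArc₁₃.dominates-N⁺v₁ v₁⇒v₃) (WithArc₁₃.dominates-N⁻v₃ v₁⇒v₃) v₃∈S a A′ P∈
  ...     | a ∷ A′ | inj₂ (¬v₁⇒v₃ , ¬v₂⇒v₃) = insert-near-v₁ v₃∈S ¬v₁⇒v₃ ¬v₂⇒v₃ a A′ P∈

digon-extension : ∀ (D : Digraph) (S : Subset (Digraph.n D)) → AntiCirculant3 D →
  (∀ U → U ⊂ ⊤ → BE-property D U) → MaxStable D ⊤ S → InClassD D →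
  ∀ {v₁ v₂ v₃} → _⇒_ D v₁ v₂ → _⇒_ D v₂ v₁ → _⇒_ D v₃ v₁ → _⇒_ D v₃ v₂ → v₂ ∉ S →
  (v₃ ∈ S → _⇒_ D v₁ v₃ ⊎ (¬ _⇒_ D v₁ v₃ × ¬ _⇒_ D v₂ v₃)) →
  ∃ λ Ps → SBE-PathPartition D ⊤ S Ps
digon-extension D S anti beProper maxStable inClassD v₁⇒v₂ v₂⇒v₁ v₃⇒v₁ v₃⇒v₂ v₂∉S =
  let _ , partition = beProper _ (PathPartitions.∁⁅⁆⊂⊤ D S _) S (PathPartitions.MaxStable-∁⁅⁆ D S maxStable v₂∉S)
  in Extension.extended D S anti inClassD v₁⇒v₂ v₂⇒v₁ v₃⇒v₁ v₃⇒v₂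
       (proj₁ (proj₂ maxStable)) v₂∉S partition

lemma13 : (D : Digraph) → (S : Subset (Digraph.n D)) →
    AntiCirculant3 D →
    (∀ U → U ⊂ ⊤ → BE-property D U) →
    MaxStable D ⊤ S →
    (v₁ v₂ : Fin (Digraph.n D)) → _⇒_ D v₁ v₂ → _⇒_ D v₂ v₁ →
    InClassD D →
    (v₃ : Fin (Digraph.n D)) → v₃ ≢ v₁ → v₃ ≢ v₂ →
    _⇒_ D v₃ v₁ → _⇒_ D v₃ v₂ →
    (v₁ ∈ S ⊎ v₂ ∈ S ⊎ v₃ ∈ S) →
    ∃ λ Ps → SBE-PathPartition D ⊤ S Ps
lemma13 D S anti beProper maxStable v₁ v₂ v₁⇒v₂ v₂⇒v₁ inClassD v₃ _ _ v₃⇒v₁ v₃⇒v₂ _ =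
  cases (v₃ ∈? S) (v₂ ∈? S) (T? (Digraph.arc D v₁ v₃)) (T? (Digraph.arc D v₂ v₃))
  where
  Result : Set
  Result = ∃ λ Ps → SBE-PathPartition D ⊤ S Ps
  excluded : ∀ {u v} → _⇒_ D u v → u ∈ S → v ∉ S
  excluded u⇒v u∈S v∈S = proj₁ (proj₂ maxStable) _ _ u∈S v∈S (inj₁ u⇒v)
  extend₁₂ : v₂ ∉ S → (v₃ ∈ S → _⇒_ D v₁ v₃ ⊎ (¬ _⇒_ D v₁ v₃ × ¬ _⇒_ D v₂ v₃)) → Result
  extend₁₂ = digon-extension D S anti beProper maxStable inClassD v₁⇒v₂ v₂⇒v₁ v₃⇒v₁ v₃⇒v₂
  extend₂₁ : v₁ ∉ S → (v₃ ∈ S → _⇒_ D v₂ v₃ ⊎ (¬ _⇒_ D v₂ v₃ × ¬ _⇒_ D v₁ v₃)) → Result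
  extend₂₁ = digon-extension D S anti beProper maxStable inClassD v₂⇒v₁ v₁⇒v₂ v₃⇒v₂ v₃⇒v₁
  cases : Dec (v₃ ∈ S) → Dec (v₂ ∈ S) → Dec (_⇒_ D v₁ v₃) → Dec (_⇒_ D v₂ v₃) → Result
  cases (no v₃∉S)  (no v₂∉S)  _           _           = extend₁₂ v₂∉S (⊥-elim ∘ v₃∉S)
  cases (no v₃∉S)  (yes v₂∈S) _           _           = extend₂₁ (excluded v₂⇒v₁ v₂∈S) (⊥-elim ∘ v₃∉S)
  cases (yes v₃∈S) _          (yes v₁⇒v₃) _           = extend₁₂ (excluded v₃⇒v₂ v₃∈S) (λ _ → inj₁ v₁⇒v₃)
  cases (yes v₃∈S) _          (no _)      (yes v₂⇒v₃) = extend₂₁ (excluded v₃⇒v₁ v₃∈S) (λ _ → inj₁ v₂⇒v₃)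
  cases (yes v₃∈S) _          (no ¬v₁⇒v₃) (no ¬v₂⇒v₃) =
    extend₁₂ (excluded v₃⇒v₂ v₃∈S) (λ _ → inj₂ (¬v₁⇒v₃ , ¬v₂⇒v₃))
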